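{- Let $k\ge 2$ be an integer. The group $\mathbb{Z}_2^{k-1}$ contains $k$ cosets $C_1,\dots,C_k$ of subgroups such that $\bigcap_{i=1}^k C_i=\emptyset$, while for every $1\le j\le k$ the intersection $\bigcap_{i\ne j}C_i$ is nonempty. -}

module Defs where

open import Level using (0ℓ; suc)
open import Data.Bool using (Bool; false; _xor_)
open import Data.Nat using (ℕ)
open import Data.Vec using (Vec; replicate; zipWith)
open import Data.Product using (_×_)

Z₂^ : ℕ → Set
Z₂^ n = Vec Bool n

0ᶻ : ∀ {n} → Z₂^ n
0ᶻ {n} = replicate n false

_⊕_ : ∀ {n} → Z₂^ n → Z₂^ n → Z₂^ n
_⊕_ = zipWith _xor_

-- Inverse in Z_2^n: every element is its own inverse.
⊖_ : ∀ {n} → Z₂^ n → Z₂^ n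
⊖ x = x

record Subgroup (n : ℕ) : Set₁ where
  field
    mem     : Z₂^ n → Set
    has-0   : mem 0ᶻ
    closed⊕ : ∀ x y → mem x → mem y → mem (x ⊕ y)
    closed⊖ : ∀ x → mem x → mem (⊖ x)

record Coset (n : ℕ) : Set₁ where
  field
    sub : Subgroup n
    rep : Z₂^ n

_∈C_ : ∀ {n} → Z₂^ n → Coset n → Set
x ∈C C = Subgroup.mem (Coset.sub C) ((⊖ Coset.rep C) ⊕ x)

-- With n = k - 1, take the n coordinate hyperplanes {x | xᵢ = 0} together with
-- the coset of odd-parity vectors.  The hyperplanes meet only in 0, which has
-- even parity, so the whole family has empty intersection.  Dropping the parity
-- coset leaves 0 in the intersection; dropping the hyperplane xⱼ = 0 leaves the
-- unit vector eⱼ, which lies in every other hyperplane and has odd parity.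
module Submission where

open import Defs
open import Algebra.Bundles using (CommutativeRing)
open import Data.Bool using (Bool; true; false; _xor_)
open import Data.Bool.Properties using (xor-same; xor-∧-commutativeRing)
open import Data.Fin using (Fin; zero; suc)
open import Data.Nat using (ℕ; suc; _≤_; _∸_; s≤s)
open import Data.Product using (Σ; ∃; _×_; _,_)
open import Data.Vec using ([]; _∷_; lookup)
open import Data.Vec.Properties using (lookup-zipWith; lookup-replicate; zipWith-replicate)
open import Data.Vec.Relation.Binary.Pointwise.Extensional using (ext; Pointwise-≡⇒≡)
open import Function using (_∘_)
open import Relation.Nullary using (¬_; contradiction)
open import Relation.Binary.PropositionalEquality
  using (_≡_; _≢_; refl; sym; trans; cong; module ≡-Reasoning)
open import Algebra.Properties.CommutativeSemigroup
  (CommutativeRing.+-commutativeSemigroup xor-∧-commutativeRing) using (interchange)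

private
  variable
    n : ℕ

xor≡false⇒≡ : ∀ a b → a xor b ≡ false → a ≡ b
xor≡false⇒≡ false b    eq = sym eq
xor≡false⇒≡ true  true eq = refl

0ᶻ⊕0ᶻ : 0ᶻ ⊕ 0ᶻ ≡ 0ᶻ {n}
0ᶻ⊕0ᶻ = zipWith-replicate _xor_ false false

module _ (f : Z₂^ n → Bool) (f-⊕ : ∀ x y → f (x ⊕ y) ≡ f x xor f y) where

  homomorphism-0ᶻ : f 0ᶻ ≡ false
  homomorphism-0ᶻ = begin
    f 0ᶻ           ≡⟨ cong f (sym 0ᶻ⊕0ᶻ) ⟩
    f (0ᶻ ⊕ 0ᶻ)    ≡⟨ f-⊕ 0ᶻ 0ᶻ ⟩
    f 0ᶻ xor f 0ᶻ  ≡⟨ xor-same (f 0ᶻ) ⟩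
    false          ∎
    where open ≡-Reasoning

  kernel : Subgroup n
  kernel = record
    { mem     = λ x → f x ≡ false
    ; has-0   = homomorphism-0ᶻ
    ; closed⊕ = λ x y fx≡0 fy≡0 → trans (f-⊕ x y) (xor-false fx≡0 fy≡0)
    ; closed⊖ = λ x fx≡0 → fx≡0
    }
    where
    xor-false : ∀ {a b} → a ≡ false → b ≡ false → a xor b ≡ false
    xor-false refl refl = refl

  kernelCoset : Z₂^ n → Coset n
  kernelCoset a = record { sub = kernel ; rep = a }

  ∈-kernelCoset⁺ : ∀ a x → f x ≡ f a → x ∈C kernelCoset a
  ∈-kernelCoset⁺ a x fx≡fa = begin
    f (a ⊕ x)    ≡⟨ f-⊕ a x ⟩
    f a xor f x  ≡⟨ cong (f a xor_) fx≡fa ⟩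
    f a xor f a  ≡⟨ xor-same (f a) ⟩
    false        ∎
    where open ≡-Reasoning

  ∈-kernelCoset⁻ : ∀ a x → x ∈C kernelCoset a → f x ≡ f a
  ∈-kernelCoset⁻ a x x∈C = sym (xor≡false⇒≡ (f a) (f x) (trans (sym (f-⊕ a x)) x∈C))

lookup-⊕ : ∀ (i : Fin n) x y → lookup (x ⊕ y) i ≡ lookup x i xor lookup y i
lookup-⊕ i x y = lookup-zipWith _xor_ i x y

parity : Z₂^ n → Bool
parity []      = false
parity (b ∷ x) = b xor parity x

parity-⊕ : ∀ (x y : Z₂^ n) → parity (x ⊕ y) ≡ parity x xor parity y
parity-⊕ []      []      = refl
parity-⊕ (a ∷ x) (b ∷ y) = begin
  (a xor b) xor parity (x ⊕ y)           ≡⟨ cong ((a xor b) xor_) (parity-⊕ x y) ⟩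
  (a xor b) xor (parity x xor parity y)  ≡⟨ interchange a b (parity x) (parity y) ⟩
  (a xor parity x) xor (b xor parity y)  ∎
  where open ≡-Reasoning

parity-0ᶻ : parity (0ᶻ {n}) ≡ false
parity-0ᶻ {n} = homomorphism-0ᶻ (parity {n}) parity-⊕

unitVector : Fin n → Z₂^ n
unitVector zero    = true ∷ 0ᶻ
unitVector (suc j) = false ∷ unitVector j

parity-unitVector : ∀ (j : Fin n) → parity (unitVector j) ≡ true
parity-unitVector {suc n} zero = cong (true xor_) (parity-0ᶻ {n})
parity-unitVector (suc j)      = parity-unitVector j

lookup-unitVector-≢ : ∀ {i j : Fin n} → i ≢ j → lookup (unitVector j) i ≡ false
lookup-unitVector-≢ {i = zero}  {zero}  i≢j = contradiction refl i≢j
lookup-unitVector-≢ {i = zero}  {suc j} i≢j = refl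
lookup-unitVector-≢ {i = suc i} {zero}  i≢j = lookup-replicate i false
lookup-unitVector-≢ {i = suc i} {suc j} i≢j = lookup-unitVector-≢ (i≢j ∘ cong suc)

coordinateHyperplane : Fin n → Coset n
coordinateHyperplane i = kernelCoset (λ x → lookup x i) (lookup-⊕ i) 0ᶻ

∈-coordinateHyperplane⁺ : ∀ (i : Fin n) x → lookup x i ≡ false → x ∈C coordinateHyperplane i
∈-coordinateHyperplane⁺ i x xᵢ≡0 =
  ∈-kernelCoset⁺ (λ y → lookup y i) (lookup-⊕ i) 0ᶻ x (trans xᵢ≡0 (sym (lookup-replicate i false)))

∈-coordinateHyperplane⁻ : ∀ (i : Fin n) x → x ∈C coordinateHyperplane i → lookup x i ≡ false
∈-coordinateHyperplane⁻ i x x∈C =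
  trans (∈-kernelCoset⁻ (λ y → lookup y i) (lookup-⊕ i) 0ᶻ x x∈C) (lookup-replicate i false)

oddParityCoset : Coset (suc n)
oddParityCoset = kernelCoset parity parity-⊕ (unitVector zero)

∈-oddParityCoset⁺ : ∀ (x : Z₂^ (suc n)) → parity x ≡ true → x ∈C oddParityCoset
∈-oddParityCoset⁺ {n} x px≡1 =
  ∈-kernelCoset⁺ parity parity-⊕ (unitVector zero) x (trans px≡1 (sym (parity-unitVector {suc n} zero)))

∈-oddParityCoset⁻ : ∀ (x : Z₂^ (suc n)) → x ∈C oddParityCoset → parity x ≡ true
∈-oddParityCoset⁻ {n} x x∈C =
  trans (∈-kernelCoset⁻ parity parity-⊕ (unitVector zero) x x∈C) (parity-unitVector {suc n} zero)

cosets : ∀ n → Fin (suc (suc n)) → Coset (suc n)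
cosets n zero    = oddParityCoset
cosets n (suc i) = coordinateHyperplane i

⋂-cosets-empty : ¬ ∃ λ (x : Z₂^ (suc n)) → ∀ i → x ∈C cosets n i
⋂-cosets-empty {n} (x , x∈C) = contradiction false≡true λ ()
  where
  open ≡-Reasoning
  x≡0ᶻ : x ≡ 0ᶻ
  x≡0ᶻ = Pointwise-≡⇒≡ (ext λ i →
    trans (∈-coordinateHyperplane⁻ i x (x∈C (suc i))) (sym (lookup-replicate i false)))

  false≡true : false ≡ true
  false≡true = begin
    false                ≡⟨ sym (parity-0ᶻ {suc n}) ⟩
    parity (0ᶻ {suc n})  ≡⟨ cong parity (sym x≡0ᶻ) ⟩
    parity x             ≡⟨ ∈-oddParityCoset⁻ x (x∈C zero) ⟩
    true                 ∎

⋂-cosets-except-nonempty : ∀ (j : Fin (suc (suc n))) →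
                           ∃ λ (x : Z₂^ (suc n)) → ∀ i → i ≢ j → x ∈C cosets n i
⋂-cosets-except-nonempty zero    = 0ᶻ , λ where
  zero    i≢j → contradiction refl i≢j
  (suc i) _   → ∈-coordinateHyperplane⁺ i 0ᶻ (lookup-replicate i false)
⋂-cosets-except-nonempty (suc j) = unitVector j , λ where
  zero    _   → ∈-oddParityCoset⁺ (unitVector j) (parity-unitVector j)
  (suc i) i≢j → ∈-coordinateHyperplane⁺ i (unitVector j) (lookup-unitVector-≢ (i≢j ∘ cong suc))

lemma2p3 : (k : ℕ) → 2 ≤ k →
    Σ (Fin k → Coset (k ∸ 1)) λ C →
      (¬ ∃ λ (x : Z₂^ (k ∸ 1)) → ∀ i → x ∈C C i)
      × (∀ (j : Fin k) → ∃ λ (x : Z₂^ (k ∸ 1)) → ∀ i → i ≢ j → x ∈C C i)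
lemma2p3 (suc (suc m)) (s≤s (s≤s _)) = cosets m , ⋂-cosets-empty , ⋂-cosets-except-nonempty
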